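{- There exists a text whose LZ-Begin parsing contains two phrases that are equal as strings; that is, not all phrases generated by an LZ-Begin parsing are different.
   Context: LZ-Begin parsing of a text $T[1,n]$: a sequence $Z[1,n']$ of phrases with $T=Z[1]\cdots Z[n']$, where each phrase consists of a leading character followed by a (possibly empty) copied part whose source must start at the starting position of some previous phrase. Concretely, having processed $T[1,i-1]$ into $Z[1,p-1]$, let $T[i+1,i']$ be the longest prefix of $T[i+1,n]$ that equals $T[s,s+i'-i-1]$ for some $s$ that is the starting position of a phrase $Z[q]$, $q<p$, with $s+i'-i-1\le i-1$; set $Z[p]=T[i,i']$ and continue with $i=i'+1$. -}

module Defs where

open import Data.Nat using (ℕ; zero; suc; _+_; _≤_; _<_)
open import Data.List using (List; []; _∷_; _++_; [_]; length; take; drop)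
open import Data.List.Membership.Propositional using (_∈_)
open import Data.Product using (Σ; ∃; _×_; _,_)
open import Data.Sum using (_⊎_)
open import Relation.Binary.PropositionalEquality using (_≡_)

-- Texts are lists of symbols over the alphabet ℕ; positions are 0-based.
Text : Set
Text = List ℕ

CopySrc : Text → List ℕ → ℕ → ℕ → Set
CopySrc T S i ℓ =
  Σ ℕ λ s → s ∈ S × s + ℓ ≤ i × suc i + ℓ ≤ length T
          × take ℓ (drop s T) ≡ take ℓ (drop (suc i) T)

-- LZBegin T i S Z : starting at position i, with S the starting positions of
-- the phrases produced so far, the LZ-Begin parsing of T[i ..] is Z.
data LZBegin (T : Text) : ℕ → List ℕ → List Text → Set where
  done : ∀ {i S} → i ≡ length T → LZBegin T i S []
  step : ∀ {i S Z} (ℓ : ℕ)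
       → i < length T
       → (ℓ ≡ 0 ⊎ CopySrc T S i ℓ)
       → (∀ ℓ' → CopySrc T S i ℓ' → ℓ' ≤ ℓ)
       → LZBegin T (suc i + ℓ) (S ++ [ i ]) Z
       → LZBegin T i S (take (suc ℓ) (drop i T) ∷ Z)

IsLZBeginParsing : Text → List Text → Set
IsLZBeginParsing T Z = LZBegin T 0 [] Z

module Submission where

-- The witness is the text T = 0 0, whose LZ-Begin parsing is the two
-- one-character phrases "0" and "0".  Both phrases are literal (their copied
-- part is empty) for two general reasons, established first:
--   * when no phrase has been produced yet there is no copy source at all
--     (`noSourceBeforeFirstPhrase`);
--   * a copy starting after position i has length at most |T| - (i + 1), so
--     at the last position of the text only the empty copy is possible
--     (`noCopyAtLastPosition`).
-- `literalPhrase` packages a parsing step whose longest copy is empty, and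
-- the theorem assembles two such steps and compares the resulting phrases.

open import Defs
open import Data.Nat using (suc; z≤n; s≤s; _≤_; _<_; _+_)
open import Data.Nat.Properties using (+-identityʳ; +-cancelˡ-≤)
open import Data.List using (List; length; lookup; []; _∷_; _++_; [_]; take; drop)
open import Data.Empty using (⊥-elim)
open import Data.Fin using (Fin; zero; suc)
open import Data.Product using (Σ; _×_; _,_)
open import Data.Sum using (inj₁)
open import Relation.Nullary using (¬_)
open import Relation.Binary.PropositionalEquality using (_≡_; _≢_; refl; subst; sym; trans)

noSourceBeforeFirstPhrase : ∀ T i ℓ → ¬ CopySrc T [] i ℓ
noSourceBeforeFirstPhrase T i ℓ (s , () , _)

noCopyAtLastPosition : ∀ T S i ℓ → suc i ≡ length T → CopySrc T S i ℓ → ℓ ≤ 0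
noCopyAtLastPosition T S i ℓ last (s , _ , _ , fits , _) =
  +-cancelˡ-≤ (suc i) ℓ 0 (subst (suc i + ℓ ≤_) lastIsEnd fits)
  where
    lastIsEnd : length T ≡ suc i + 0
    lastIsEnd = trans (sym last) (sym (+-identityʳ (suc i)))

literalPhrase : ∀ {T i S Z}
  → i < length T
  → (∀ ℓ → CopySrc T S i ℓ → ℓ ≤ 0)
  → LZBegin T (suc i) (S ++ [ i ]) Z
  → LZBegin T i S (take 1 (drop i T) ∷ Z)
literalPhrase {T} {i} {S} {Z} inText onlyEmpty rest =
  step 0 inText (inj₁ refl) onlyEmpty
       (subst (λ j → LZBegin T j (S ++ [ i ]) Z) (sym (+-identityʳ (suc i))) rest)

lemma4p10 : Σ Text λ T → Σ (List Text) λ Z → IsLZBeginParsing T Z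
    × Σ (Fin (length Z)) λ p → Σ (Fin (length Z)) λ q
    → p ≢ q × lookup Z p ≡ lookup Z q
lemma4p10 = T , Z , parsing , zero , suc zero , (λ ()) , refl
  where
    T : Text
    T = 0 ∷ 0 ∷ []

    Z : List Text
    Z = [ 0 ] ∷ [ 0 ] ∷ []

    parsing : IsLZBeginParsing T Z
    parsing =
      literalPhrase (s≤s z≤n)
        (λ ℓ src → ⊥-elim (noSourceBeforeFirstPhrase T 0 ℓ src))
        (literalPhrase (s≤s (s≤s z≤n))
          (λ ℓ → noCopyAtLastPosition T [ 0 ] 1 ℓ refl)
          (done refl))
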